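{- Let $G=(V,V_0,V_1,E,c)$ be a parity game, let $X\subseteq V$ be a nonempty set of nodes all having the same color $c_X$, and let $p=c_X \bmod 2$. Suppose that $\mathrm{MAttr}(X)$ is fatal, i.e. $X\subseteq \mathrm{MAttr}(X)$. Then every attractor strategy of player $p$ for $\mathrm{MAttr}(X)$ is winning for player $p$ on $\mathrm{MAttr}(X)$: every play that starts in a node of $\mathrm{MAttr}(X)$ and is consistent with such a strategy is won by player $p$.
   Context: A parity game is a tuple $G=(V,V_0,V_1,E,c)$ where $V$ is a finite set of nodes partitioned into $V_0$ and $V_1$ (nodes owned by players $0$ and $1$), $E\subseteq V\times V$ is such that every node has at least one successor, and $c\colon V\to\mathbb{N}$ is a coloring. For $v\in V$ let $v.E=\{w\mid (v,w)\in E\}$. A play is an infinite sequence $v_0v_1\dots$ with $(v_i,v_{i+1})\in E$, where the owner of $v_i$ chooses $v_{i+1}$; player $0$ wins the play iff the minimal color occurring infinitely often is even, otherwise player $1$ wins. A strategy for player $p$ is a function $\tau\colon V_p\to V$ with $(v,\tau(v))\in E$; a play is consistent with $\tau$ if $v_{i+1}=\tau(v_i)$ whenever $v_i\in V_p$. For node sets $A,X$, player $p\in\{0,1\}$ and color $c$, define the monotone control predecessor $\mathrm{mpre}_p(A,X,c)=\{v\in V_p\mid c(v)\geq c \wedge v.E\cap(A\cup X)\neq\emptyset\}\cup\{v\in V_{1-p}\mid c(v)\geq c\wedge v.E\subseteq A\cup X\}$. For a nonempty set $X$ of nodes all of color $c_X$ with $p=c_X\bmod 2$, let $Z_0=\emptyset$,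 $Z_{i+1}=\mathrm{mpre}_p(Z_i,X,c_X)$, and $\mathrm{MAttr}(X)=\bigcup_i Z_i$ (the least fixed point of $Z\mapsto \mathrm{mpre}_p(Z,X,c_X)$; note $X$ itself is not added by default). $\mathrm{MAttr}(X)$ is called fatal if $X\subseteq\mathrm{MAttr}(X)$. An attractor strategy of player $p$ for $\mathrm{MAttr}(X)$ is a strategy that, at each node $v\in V_p\cap \mathrm{MAttr}(X)$ with $i\geq 1$ minimal such that $v\in Z_i$, moves to a successor of $v$ in $Z_{i-1}\cup X$ (such a successor exists by definition). -}

module Defs where

open import Data.Nat using (ℕ; zero; suc; _≤_; _≥_; _%_)
open import Data.Fin using (Fin; toℕ)
open import Data.Product using (Σ; ∃; ∃-syntax; _×_; proj₁)
open import Data.Sum using (_⊎_)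
open import Data.Empty using (⊥)
open import Relation.Nullary using (¬_)
open import Relation.Binary.PropositionalEquality using (_≡_)

-- A parity game on the finite node set V = Fin n.
-- owner v ∈ Fin 2 says whether v ∈ V₀ (owner 0) or v ∈ V₁ (owner 1).
record ParityGame : Set₁ where
  field
    n     : ℕ
    owner : Fin n → Fin 2
    E     : Fin n → Fin n → Set
    total : ∀ v → ∃[ w ] E v w
    col   : Fin n → ℕ

module _ (G : ParityGame) where
  open ParityGame G

  Node : Set
  Node = Fin n

  NodeSet : Set₁
  NodeSet = Node → Set

  Owned : ℕ → Node → Set
  Owned p v = toℕ (owner v) ≡ p

  mpre : ℕ → NodeSet → NodeSet → ℕ → NodeSet
  mpre p A X c v =
      (Owned p v × col v ≥ c × ∃[ w ] (E v w × (A w ⊎ X w)))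
    ⊎ (¬ Owned p v × col v ≥ c × (∀ w → E v w → A w ⊎ X w))

  Z : NodeSet → ℕ → ℕ → NodeSet
  Z X cX zero    v = ⊥
  Z X cX (suc i) v = mpre (cX % 2) (Z X cX i) X cX v

  MAttr : NodeSet → ℕ → NodeSet
  MAttr X cX v = ∃[ i ] Z X cX i v

  Strategy : ℕ → Set
  Strategy p = (v : Node) → Owned p v → Σ Node (λ w → E v w)

  -- attractor strategy of player p = cX mod 2 for MAttr(X): at v ∈ V_p with
  -- i ≥ 1 minimal such that v ∈ Z_i (here i = suc j), move into Z_{i-1} ∪ X.
  IsAttractorStrategy : (X : NodeSet) (cX : ℕ) → Strategy (cX % 2) → Set
  IsAttractorStrategy X cX τ =
    ∀ (v : Node) (o : Owned (cX % 2) v) (j : ℕ) →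
      Z X cX (suc j) v →
      (∀ k → k ≤ j → ¬ Z X cX k v) →
      Z X cX j (proj₁ (τ v o)) ⊎ X (proj₁ (τ v o))

  IsPlay : (ℕ → Node) → Set
  IsPlay π = ∀ k → E (π k) (π (suc k))

  ConsistentWith : (p : ℕ) → Strategy p → (ℕ → Node) → Set
  ConsistentWith p τ π = ∀ k (o : Owned p (π k)) → π (suc k) ≡ proj₁ (τ (π k) o)

  InfOften : (ℕ → Node) → ℕ → Set
  InfOften π d = ∀ k → ∃[ j ] (k ≤ j × col (π j) ≡ d)

  Wins : ℕ → (ℕ → Node) → Set
  Wins p π = ∃[ d ] (InfOften π d × (∀ d′ → InfOften π d′ → d ≤ d′) × d % 2 ≡ p)

module Submission where

-- Every node v of MAttr(X) has a rank: the least r with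
-- v ∈ Z_{r+1}.  Along a play that follows an attractor strategy, a node of
-- rank r is followed by a node of Z_r ∪ X, so the play never leaves MAttr(X)
-- (fatality puts X inside it) and, as long as it avoids X, the rank strictly
-- decreases.  Hence a stretch of n+1 consecutive positions cannot avoid X:
-- by pigeonhole it would revisit a node with a strictly smaller rank.  So X,
-- and with it the colour cX, occurs infinitely often, while every node of
-- MAttr(X) has colour ≥ cX; thus cX is the least colour seen infinitely
-- often, and its parity is p = cX mod 2.
--
-- Membership in Z_i is not decidable here, so the existence of ranks and the
-- invariant "the play stays in MAttr(X)" are established under double
-- negation (the ¬¬-monad); they are only ever used to derive ⊥ or decidable
-- facts.

open import Defs
open import Data.Nat using (ℕ; zero; suc; _+_; _∸_; _%_; _≤_; _<_; z≤n; s≤s; s≤s⁻¹; _≟_; _≤?_)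
open import Data.Nat.Properties
open import Data.Fin using (toℕ; fromℕ<)
open import Data.Fin.Properties using (pigeonhole; any?; toℕ≤pred[n]; toℕ-fromℕ<)
open import Data.Product using (∃; ∃-syntax; _×_; _,_; proj₁)
open import Data.Sum using (_⊎_; inj₁; inj₂; [_,_]′)
open import Data.Empty using (⊥; ⊥-elim)
open import Effect.Monad using (RawMonad)
open import Level using (0ℓ)
open import Relation.Nullary using (¬_; yes; no; contradiction)
open import Relation.Nullary.Negation using (¬¬-Monad; ¬¬-map)
open import Relation.Nullary.Decidable using (decidable-stable)
open import Relation.Binary.PropositionalEquality using (_≡_; _≢_; refl; sym; trans; cong; subst)

open RawMonad (¬¬-Monad {0ℓ}) using (_>>=_; pure)

escape : ¬ ¬ ⊥ → ⊥
escape ¬¬⊥ = ¬¬⊥ (λ ())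

least-number : ∀ {ℓ} (P : ℕ → Set ℓ) {i : ℕ} → P i →
               ¬ ¬ (∃[ m ] (P m × (∀ k → k < m → ¬ P k)))
least-number P {i} pᵢ noLeast = nowhere i i ≤-refl pᵢ
  where
  nowhere : ∀ b k → k ≤ b → ¬ P k
  nowhere zero .zero z≤n p = noLeast (zero , p , λ _ ())
  nowhere (suc b) k k≤b+1 p with m≤n⇒m<n∨m≡n k≤b+1
  ... | inj₁ k<b+1 = nowhere b k (s≤s⁻¹ k<b+1) p
  ... | inj₂ refl  = noLeast (suc b , p , λ j j<k → nowhere b j (s≤s⁻¹ j<k))

module Layers (G : ParityGame) (X : NodeSet G) (cX : ℕ) where
  open ParityGame G

  Layer : ℕ → NodeSet G
  Layer = Z G X cX

  layer-col : ∀ {i v} → Layer i v → cX ≤ col v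
  layer-col {suc _} (inj₁ (_ , c≥ , _)) = c≥
  layer-col {suc _} (inj₂ (_ , c≥ , _)) = c≥

  -- v has rank r: it enters the attractor exactly at layer r + 1; this is
  -- the situation in which IsAttractorStrategy constrains the move at v
  Rank : Node G → ℕ → Set
  Rank v r = Layer (suc r) v × (∀ k → k ≤ r → ¬ Layer k v)

  rank-below : ∀ {i v r} → Layer i v → Rank v r → r < i
  rank-below {i} z (_ , outside) = ≰⇒> (λ i≤r → outside i i≤r z)

  rank-unique : ∀ {v r s} → Rank v r → Rank v s → r ≡ s
  rank-unique ρ σ =
    ≤-antisym (s≤s⁻¹ (rank-below (proj₁ σ) ρ)) (s≤s⁻¹ (rank-below (proj₁ ρ) σ))

  -- every attractor node (not refutably) has a rank; Z_0 is empty, so the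
  -- least layer containing v is a successor layer
  rank-exists : ∀ {i v} → Layer i v → ¬ ¬ ∃ (Rank v)
  rank-exists {v = v} z = ¬¬-map toRank (least-number (λ i → Layer i v) z)
    where
    toRank : ∃[ m ] (Layer m v × (∀ k → k < m → ¬ Layer k v)) → ∃ (Rank v)
    toRank (suc r , z′ , below) = r , z′ , λ k k≤r → below k (s≤s k≤r)

module AttractorPlay
    (G : ParityGame) (X : NodeSet G) (cX : ℕ)
    (fatal : ∀ v → X v → MAttr G X cX v)
    (τ : Strategy G (cX % 2)) (attractor : IsAttractorStrategy G X cX τ)
    (π : ℕ → Node G) (play : IsPlay G π) (start : MAttr G X cX (π 0))
    (consistent : ConsistentWith G (cX % 2) τ π) where

  open ParityGame G
  open Layers G X cX

  -- from a node of rank r the play moves into Z_r ∪ X: player p by the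
  -- attractor strategy, the opponent because all his moves lead there
  attractor-step : ∀ m {r} → Rank (π m) r → Layer r (π (suc m)) ⊎ X (π (suc m))
  attractor-step m {r} (z , outside) with toℕ (owner (π m)) ≟ cX % 2
  ... | yes own = subst (λ w → Layer r w ⊎ X w) (sym (consistent m own)) (attractor (π m) own r z outside)
  ... | no ¬own with z
  ...   | inj₁ (own , _)      = contradiction own ¬own
  ...   | inj₂ (_ , _ , all) = all (π (suc m)) (play m)

  -- the play never leaves MAttr(X): fatality covers the steps into X
  stays : ∀ m → ¬ ¬ MAttr G X cX (π m)
  stays zero = pure start
  stays (suc m) = do
    (_ , z) ← stays m
    (r , ρ) ← rank-exists z
    pure ([ (r ,_) , fatal (π (suc m)) ]′ (attractor-step m ρ))

  descend : ∀ m {r} → Rank (π m) r → ¬ X (π (suc m)) →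
            ¬ ¬ (∃[ r′ ] (Rank (π (suc m)) r′ × r′ < r))
  descend m ρ ¬x with attractor-step m ρ
  ... | inj₂ x = contradiction x ¬x
  ... | inj₁ z = do
    (r′ , ρ′) ← rank-exists z
    pure (r′ , ρ′ , rank-below z ρ′)

  module Segment (k L : ℕ) (avoid : ∀ t → t ≤ L → ¬ X (π (t + k))) where

    rank-descent : ∀ a {r} → Rank (π (a + k)) r → ∀ d → d + a ≤ L →
                   ¬ ¬ (∃[ r′ ] (Rank (π (d + a + k)) r′ × r′ + d ≤ r))
    rank-descent a {r} ρ zero _ = pure (r , ρ , ≤-reflexive (+-identityʳ r))
    rank-descent a ρ (suc d) bound = do
      (r₁ , ρ₁ , r₁+d≤r) ← rank-descent a ρ d (<⇒≤ bound)
      (r₂ , ρ₂ , r₂<r₁) ← descend (d + a + k) ρ₁ (avoid (suc d + a) bound)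
      pure (r₂ , ρ₂ , ≤-trans (≤-reflexive (+-suc r₂ d)) (≤-trans (+-monoˡ-≤ d r₂<r₁) r₁+d≤r))

    no-revisit : ∀ a d → suc d + a ≤ L → π (a + k) ≢ π (suc d + a + k)
    no-revisit a d bound same = escape (do
      (_ , z) ← stays (a + k)
      (r , ρ) ← rank-exists z
      (r′ , ρ′ , r′+d+1≤r) ← rank-descent a ρ (suc d) bound
      let r′≡r = rank-unique (subst (λ v → Rank v r′) (sym same) ρ′) ρ
      pure (m+1+n≰m r′ (subst (λ s → r′ + suc d ≤ s) (sym r′≡r) r′+d+1≤r)))

  X-recurs : ∀ k → ¬ (∀ t → t ≤ n → ¬ X (π (t + k)))
  X-recurs k avoid
    with i , j , i<j , same ← pigeonhole (n<1+n n) (λ t → π (toℕ t + k)) =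
    Segment.no-revisit k n avoid (toℕ i) d (subst (_≤ n) (sym gap) (toℕ≤pred[n] j))
      (trans same (cong (λ b → π (b + k)) (sym gap)))
    where
    d : ℕ
    d = toℕ j ∸ suc (toℕ i)
    gap : suc d + toℕ i ≡ toℕ j
    gap = trans (sym (+-suc d (toℕ i))) (m∸n+n≡m i<j)

  cX-recurs : (∀ v → X v → col v ≡ cX) → InfOften G π cX
  cX-recurs colX k with any? (λ t → col (π (toℕ t + k)) ≟ cX)
  ... | yes (t , hit) = toℕ t + k , m≤n+m k (toℕ t) , hit
  ... | no miss = ⊥-elim (X-recurs k λ t t≤n x →
        miss (fromℕ< (s≤s t≤n) ,
              subst (λ s → col (π (s + k)) ≡ cX) (sym (toℕ-fromℕ< (s≤s t≤n))) (colX _ x)))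

  cX-minimal : ∀ d → InfOften G π d → cX ≤ d
  cX-minimal d often with often 0
  ... | j , _ , col≡d =
    decidable-stable (cX ≤? d) (¬¬-map (λ (_ , z) → subst (cX ≤_) col≡d (layer-col z)) (stays j))

theorem2 : (G : ParityGame) (X : NodeSet G) (cX : ℕ) →
    ∃[ x ] X x →
    (∀ v → X v → ParityGame.col G v ≡ cX) →
    (∀ v → X v → MAttr G X cX v) →
    (τ : Strategy G (cX % 2)) → IsAttractorStrategy G X cX τ →
    (π : ℕ → Node G) → IsPlay G π → MAttr G X cX (π 0) →
    ConsistentWith G (cX % 2) τ π →
    Wins G (cX % 2) π
theorem2 G X cX _ colX fatal τ attractor π play start consistent =
  cX , cX-recurs colX , cX-minimal , refl
  where open AttractorPlay G X cX fatal τ attractor π play start consistent
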